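{- For any two integers $r,t\geq 1$, \[ \mathrm{oh}(S_r\boxtimes S_t)\geq \begin{cases} r+1, & \text{if } r=t,\\ \min\{r,t\}+2, & \text{otherwise,}\end{cases} \] where $S_k$ denotes the star with $k$ leaves.
   Context: $\mathrm{oh}(G)$ (Odd Hadwiger number) of a finite simple graph $G$ is the largest integer $m$ for which there exist $m$ pairwise vertex-disjoint trees $Z_1,\dots,Z_m$ in $G$ and a 2-colouring $c$ of $V(Z_1)\cup\dots\cup V(Z_m)$ that is proper on each $Z_k$, such that for every $k\neq k'$ there is an edge $xy\in E(G)$ with $x\in V(Z_k)$, $y\in V(Z_{k'})$, $c(x)=c(y)$. The strong product $G\boxtimes H$ has vertex set $V(G)\times V(H)$, with $(v_1,u_1)\sim(v_2,u_2)$ iff ($v_1=v_2$ and $u_1u_2\in E(H)$), or ($u_1=u_2$ and $v_1v_2\in E(G)$), or ($v_1v_2\in E(G)$ and $u_1u_2\in E(H)$). -}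

module Defs where

open import Level using (0ℓ)
open import Data.Nat using (ℕ; zero; suc; _≤_)
open import Data.Fin using (Fin; zero; suc)
open import Data.Bool using (Bool)
open import Data.List using (List; []; _∷_)
open import Data.List.Membership.Propositional using (_∈_; _∉_)
open import Data.List.Relation.Unary.All using (All)
open import Data.Product using (Σ; ∃; _×_; _,_; proj₁; proj₂)
open import Data.Sum using (_⊎_)
open import Data.Unit using (⊤)
open import Data.Empty using (⊥)
open import Relation.Nullary using (¬_)
open import Relation.Binary.PropositionalEquality using (_≡_; _≢_)

record Graph : Set₁ where
  field
    V     : Set
    Adj   : V → V → Set
    sym   : ∀ {x y} → Adj x y → Adj y x
    irrefl : ∀ {x} → ¬ Adj x x

open Graph public

StarAdj : ∀ {k} → Fin (suc k) → Fin (suc k) → Set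
StarAdj zero    zero    = ⊥
StarAdj zero    (suc _) = ⊤
StarAdj (suc _) zero    = ⊤
StarAdj (suc _) (suc _) = ⊥

Star : ℕ → Graph
Star k = record
  { V = Fin (suc k)
  ; Adj = StarAdj
  ; sym = λ { {zero} {suc _} p → p ; {suc _} {zero} p → p }
  ; irrefl = λ { {zero} () ; {suc _} () }
  }

⊠Adj : (G H : Graph) → V G × V H → V G × V H → Set
⊠Adj G H (v₁ , u₁) (v₂ , u₂) =
  (v₁ ≡ v₂ × Adj H u₁ u₂) ⊎ (u₁ ≡ u₂ × Adj G v₁ v₂) ⊎ (Adj G v₁ v₂ × Adj H u₁ u₂)

_⊠_ : Graph → Graph → Graph
G ⊠ H = record
  { V = V G × V H
  ; Adj = ⊠Adj G H
  ; sym = λ { (Data.Sum.inj₁ (Relation.Binary.PropositionalEquality.refl , a)) →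
                 Data.Sum.inj₁ (Relation.Binary.PropositionalEquality.refl , Graph.sym H a)
            ; (Data.Sum.inj₂ (Data.Sum.inj₁ (Relation.Binary.PropositionalEquality.refl , a))) →
                 Data.Sum.inj₂ (Data.Sum.inj₁ (Relation.Binary.PropositionalEquality.refl , Graph.sym G a))
            ; (Data.Sum.inj₂ (Data.Sum.inj₂ (a , b))) →
                 Data.Sum.inj₂ (Data.Sum.inj₂ (Graph.sym G a , Graph.sym H b)) }
  ; irrefl = λ { (Data.Sum.inj₁ (_ , a)) → Graph.irrefl H a
               ; (Data.Sum.inj₂ (Data.Sum.inj₁ (_ , a))) → Graph.irrefl G a
               ; (Data.Sum.inj₂ (Data.Sum.inj₂ (a , _))) → Graph.irrefl G a }
  }

data IsTree (G : Graph) : List (V G) → List (V G × V G) → Set where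
  single : (v : V G) → IsTree G (v ∷ []) []
  grow   : ∀ {vs es} → IsTree G vs es → (u w : V G) → w ∈ vs → u ∉ vs →
           Adj G u w → IsTree G (u ∷ vs) ((u , w) ∷ es)

-- An odd-minor model of K_m in G: m pairwise vertex-disjoint trees and a
-- 2-colouring proper on each tree, with a monochromatic edge between every
-- two distinct trees.
record OddModel (G : Graph) (m : ℕ) : Set where
  field
    verts    : Fin m → List (V G)
    edges    : Fin m → List (V G × V G)
    tree     : ∀ k → IsTree G (verts k) (edges k)
    disjoint : ∀ k k' → k ≢ k' → ∀ x → x ∈ verts k → x ∉ verts k'
    colour   : V G → Bool
    proper   : ∀ k → All (λ e → colour (proj₁ e) ≢ colour (proj₂ e)) (edges k)
    touch    : ∀ k k' → k ≢ k' → Σ (V G) λ x → Σ (V G) λ y →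
                 x ∈ verts k × y ∈ verts k' × Adj G x y × colour x ≡ colour y

-- oh(G) ≥ n  (oh(G) is the largest m admitting an OddModel).
OhAtLeast : Graph → ℕ → Set
OhAtLeast G n = Σ ℕ λ m → n ≤ m × OddModel G m

{-# OPTIONS --safe #-}
-- For leaves a_i of S_{k+1} and b_i of S_k (i < k), with centres c, take the
-- paths (c, b_i) – (a_i, b_i) – (a_i, c), coloured so that only the middle
-- vertex differs from the rest. Two such paths always touch through the
-- monochromatic diagonal edge (a_i, c) – (c, b_j). Together with the centre
-- (c, c) and the vertex (a*, c) on the spare leaf a* of S_{k+1}, which is
-- adjacent to the centre and to every (c, b_i), this is an odd K_{k+2} model.
-- It embeds into S_r ⊠ S_t with k = r − 1 when r = t, and k = min r t otherwise.
module Submission where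

open import Defs
open import Data.Nat using (ℕ; _≤_; _+_; _⊓_; _<_; suc; zero; s≤s)
open import Data.Nat.Properties
  using (<-cmp; ≤-refl; n≤1+n; n<1+n; +-comm; m≤n⇒m⊓n≡m; m≥n⇒m⊓n≡n; <⇒≤)
open import Data.Fin using (Fin; zero; suc; inject≤)
open import Data.Bool using (Bool; true; false)
open import Data.List using (List; []; _∷_; map)
open import Data.List.Relation.Unary.Any using (here; there)
open import Data.List.Relation.Unary.All as All using (All; []; _∷_)
open import Data.List.Relation.Unary.All.Properties using (map⁺)
open import Data.List.Membership.Propositional using (_∈_; _∉_)
open import Data.List.Membership.Propositional.Properties using (∈-map⁺; ∈-map⁻)
open import Data.Product using (Σ; _×_; _,_; proj₁; proj₂; swap) renaming (map to map×)
open import Data.Sum using (inj₁; inj₂)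
open import Data.Unit using (tt)
open import Data.Empty using (⊥-elim)
open import Function using (_∘_)
open import Relation.Binary.PropositionalEquality
  using (_≡_; _≢_; refl; cong; cong₂; trans) renaming (sym to ≡-sym)
open import Relation.Binary.Definitions using (tri<; tri≈; tri>)

Touching : (G : Graph) → (V G → Bool) → List (V G) → List (V G) → Set
Touching G c A B =
  Σ (V G) λ x → Σ (V G) λ y → x ∈ A × y ∈ B × Adj G x y × c x ≡ c y

Touching-sym : ∀ {G c A B} → Touching G c A B → Touching G c B A
Touching-sym {G} (x , y , x∈A , y∈B , xy , cx≡cy) =
  y , x , y∈B , x∈A , Graph.sym G xy , ≡-sym cx≡cy

-- The left inverse is what turns a colouring of G into one of H.
record Embedding (G H : Graph) : Set where
  field
    to      : V G → V H
    from    : V H → V G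
    from-to : ∀ x → from (to x) ≡ x
    to-adj  : ∀ {x y} → Adj G x y → Adj H (to x) (to y)

  to-injective : ∀ {x y} → to x ≡ to y → x ≡ y
  to-injective {x} {y} eq = trans (≡-sym (from-to x)) (trans (cong from eq) (from-to y))

  ∈-map-to⁻ : ∀ {x xs} → to x ∈ map to xs → x ∈ xs
  ∈-map-to⁻ m with ∈-map⁻ to m
  ... | _ , x′∈xs , eq rewrite to-injective eq = x′∈xs

  IsTree-map : ∀ {vs es} → IsTree G vs es → IsTree H (map to vs) (map (map× to to) es)
  IsTree-map (single v)               = single (to v)
  IsTree-map (grow T u w w∈vs u∉vs uw) =
    grow (IsTree-map T) (to u) (to w) (∈-map⁺ to w∈vs) (u∉vs ∘ ∈-map-to⁻) (to-adj uw)

  OddModel-map : ∀ {m} → OddModel G m → OddModel H m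
  OddModel-map M = record
    { verts    = map to ∘ verts
    ; edges    = map (map× to to) ∘ edges
    ; tree     = IsTree-map ∘ tree
    ; disjoint = disjoint′
    ; colour   = colour ∘ from
    ; proper   = λ k → map⁺ (All.map proper′ (proper k))
    ; touch    = λ k k′ k≢k′ → touch′ (touch k k′ k≢k′)
    }
    where
    open OddModel M

    colour-from-to : ∀ x → colour (from (to x)) ≡ colour x
    colour-from-to = cong colour ∘ from-to

    proper′ : ∀ {e} → colour (proj₁ e) ≢ colour (proj₂ e) →
              colour (from (to (proj₁ e))) ≢ colour (from (to (proj₂ e)))
    proper′ {x , y} cx≢cy eq =
      cx≢cy (trans (≡-sym (colour-from-to x)) (trans eq (colour-from-to y)))

    disjoint′ : ∀ k k′ → k ≢ k′ → ∀ y → y ∈ map to (verts k) → y ∉ map to (verts k′)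
    disjoint′ k k′ k≢k′ y y∈k y∈k′ with ∈-map⁻ to y∈k | ∈-map⁻ to y∈k′
    ... | x , x∈k , refl | x′ , x′∈k′ , eq rewrite to-injective eq =
      disjoint k k′ k≢k′ x′ x∈k x′∈k′

    touch′ : ∀ {A B} → Touching G colour A B → Touching H (colour ∘ from) (map to A) (map to B)
    touch′ (x , y , x∈A , y∈B , xy , cx≡cy) =
      to x , to y , ∈-map⁺ to x∈A , ∈-map⁺ to y∈B , to-adj xy ,
      trans (colour-from-to x) (trans cx≡cy (≡-sym (colour-from-to y)))

OhAtLeast-map : ∀ {G H n} → Embedding G H → OhAtLeast G n → OhAtLeast H n
OhAtLeast-map φ (m , n≤m , M) = m , n≤m , Embedding.OddModel-map φ M

⊠-swap : ∀ G H → Embedding (G ⊠ H) (H ⊠ G)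
⊠-swap G H = record { to = swap ; from = swap ; from-to = λ _ → refl ; to-adj = swap-adj }
  where
  swap-adj : ∀ {x y} → Adj (G ⊠ H) x y → Adj (H ⊠ G) (swap x) (swap y)
  swap-adj (inj₁ vv)        = inj₂ (inj₁ vv)
  swap-adj (inj₂ (inj₁ uu)) = inj₁ uu
  swap-adj (inj₂ (inj₂ uv)) = inj₂ (inj₂ (swap uv))

⊠-mono : ∀ {G G′ H H′} → Embedding G G′ → Embedding H H′ → Embedding (G ⊠ H) (G′ ⊠ H′)
⊠-mono {G} {G′} {H} {H′} φ ψ = record
  { to      = map× (to φ) (to ψ)
  ; from    = map× (from φ) (from ψ)
  ; from-to = λ (x , y) → cong₂ _,_ (from-to φ x) (from-to ψ y)
  ; to-adj  = mono-adj
  }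
  where
  open Embedding

  mono-adj : ∀ {x y} → Adj (G ⊠ H) x y →
             Adj (G′ ⊠ H′) (map× (to φ) (to ψ) x) (map× (to φ) (to ψ) y)
  mono-adj (inj₁ (refl , vv))        = inj₁ (refl , to-adj ψ vv)
  mono-adj (inj₂ (inj₁ (refl , uu))) = inj₂ (inj₁ (refl , to-adj φ uu))
  mono-adj (inj₂ (inj₂ (uu , vv)))   = inj₂ (inj₂ (to-adj φ uu , to-adj ψ vv))

-- Out-of-range indices are sent to zero (the centre of a star).
clamp : ∀ {m n} → Fin n → Fin (suc m)
clamp         zero    = zero
clamp {zero}  (suc _) = zero
clamp {suc m} (suc i) = suc (clamp i)

clamp-inject≤ : ∀ {m n} (i : Fin (suc m)) (le : suc m ≤ n) → clamp (inject≤ i le) ≡ i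
clamp-inject≤ {n = suc _} zero             le = refl
clamp-inject≤ {suc m} {suc _} (suc i) (s≤s le) = cong suc (clamp-inject≤ i le)

Star-mono : ∀ {a b} → a ≤ b → Embedding (Star a) (Star b)
Star-mono {a} {b} a≤b = record
  { to      = λ i → inject≤ i (s≤s a≤b)
  ; from    = clamp
  ; from-to = λ i → clamp-inject≤ i (s≤s a≤b)
  ; to-adj  = λ {x} {y} → inject≤-adj x y
  }
  where
  inject≤-adj : ∀ x y → StarAdj x y → StarAdj (inject≤ x (s≤s a≤b)) (inject≤ y (s≤s a≤b))
  inject≤-adj zero    (suc _) _ = tt
  inject≤-adj (suc _) zero    _ = tt

module SpareLeafModel (k : ℕ) where

  G : Graph
  G = Star (suc k) ⊠ Star k

  centre spare : V G
  centre = zero , zero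
  spare  = suc zero , zero

  path : Fin k → List (V G)
  path i = (zero , suc i) ∷ (suc (suc i) , suc i) ∷ (suc (suc i) , zero) ∷ []

  path-edges : Fin k → List (V G × V G)
  path-edges i = ((zero , suc i) , (suc (suc i) , suc i)) ∷
                 ((suc (suc i) , suc i) , (suc (suc i) , zero)) ∷ []

  path-tree : ∀ i → IsTree G (path i) (path-edges i)
  path-tree i =
    grow (grow (single (suc (suc i) , zero))
               (suc (suc i) , suc i) (suc (suc i) , zero) (here refl)
               (λ { (here ()) ; (there ()) }) (inj₁ (refl , tt)))
         (zero , suc i) (suc (suc i) , suc i) (here refl)
         (λ { (here ()) ; (there (here ())) ; (there (there ())) }) (inj₂ (inj₁ (refl , tt)))

  verts : Fin (2 + k) → List (V G)
  verts zero          = centre ∷ []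
  verts (suc zero)    = spare ∷ []
  verts (suc (suc i)) = path i

  edges : Fin (2 + k) → List (V G × V G)
  edges (suc (suc i)) = path-edges i
  edges _             = []

  tree : ∀ a → IsTree G (verts a) (edges a)
  tree zero          = single centre
  tree (suc zero)    = single spare
  tree (suc (suc i)) = path-tree i

  -- Every vertex lies in at most one branch set, namely that of its owner
  -- (the value on the unused vertices is arbitrary).
  owner : V G → Fin (2 + k)
  owner (zero , zero)        = zero
  owner (suc zero , zero)    = suc zero
  owner (suc zero , suc _)   = zero
  owner (zero , suc i)       = suc (suc i)
  owner (suc (suc i) , _)    = suc (suc i)

  owner-∈ : ∀ {a x} → x ∈ verts a → owner x ≡ a
  owner-∈ {zero}        (here refl)                 = refl
  owner-∈ {suc zero}    (here refl)                 = refl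
  owner-∈ {suc (suc i)} (here refl)                 = refl
  owner-∈ {suc (suc i)} (there (here refl))         = refl
  owner-∈ {suc (suc i)} (there (there (here refl))) = refl

  disjoint : ∀ a b → a ≢ b → ∀ x → x ∈ verts a → x ∉ verts b
  disjoint a b a≢b x x∈a x∈b = a≢b (trans (≡-sym (owner-∈ x∈a)) (owner-∈ x∈b))

  colour : V G → Bool
  colour (suc _ , suc _) = false
  colour _               = true

  proper : ∀ a → All (λ e → colour (proj₁ e) ≢ colour (proj₂ e)) (edges a)
  proper zero          = []
  proper (suc zero)    = []
  proper (suc (suc i)) = (λ ()) ∷ (λ ()) ∷ []

  centre-adj : ∀ {a} → Adj G centre (suc a , zero)
  centre-adj = inj₂ (inj₁ (refl , tt))

  diagonal-adj : ∀ {a b} → Adj G (suc a , zero) (zero , suc b)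
  diagonal-adj = inj₂ (inj₂ (tt , tt))

  touch : ∀ a b → a ≢ b → Touching G colour (verts a) (verts b)
  touch zero          zero          a≢b = ⊥-elim (a≢b refl)
  touch zero          (suc zero)    _   =
    centre , spare , here refl , here refl , centre-adj , refl
  touch zero          (suc (suc j)) _   =
    centre , (suc (suc j) , zero) , here refl , there (there (here refl)) , centre-adj , refl
  touch (suc zero)    zero          _   = Touching-sym {G} {colour} (touch zero (suc zero) (λ ()))
  touch (suc zero)    (suc zero)    a≢b = ⊥-elim (a≢b refl)
  touch (suc zero)    (suc (suc j)) _   =
    spare , (zero , suc j) , here refl , here refl , diagonal-adj , refl
  touch (suc (suc i)) zero          _   = Touching-sym {G} {colour} (touch zero (suc (suc i)) (λ ()))
  touch (suc (suc i)) (suc zero)    _   = Touching-sym {G} {colour} (touch (suc zero) (suc (suc i)) (λ ()))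
  touch (suc (suc i)) (suc (suc j)) _   =
    (suc (suc i) , zero) , (zero , suc j) , there (there (here refl)) , here refl , diagonal-adj , refl

  model : OddModel G (2 + k)
  model = record { verts = verts ; edges = edges ; tree = tree ; disjoint = disjoint
                 ; colour = colour ; proper = proper ; touch = touch }

oh-Star⊠Star : ∀ {k r t} → k < r → k ≤ t → OhAtLeast (Star r ⊠ Star t) (2 + k)
oh-Star⊠Star {k} k<r k≤t =
  OhAtLeast-map (⊠-mono (Star-mono k<r) (Star-mono k≤t)) (2 + k , ≤-refl , SpareLeafModel.model k)

oh-Star⊠Star′ : ∀ {k r t} → k ≤ r → k < t → OhAtLeast (Star r ⊠ Star t) (2 + k)
oh-Star⊠Star′ {r = r} {t} k≤r k<t = OhAtLeast-map (⊠-swap (Star t) (Star r)) (oh-Star⊠Star k<t k≤r)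

lemma10 : (r t : ℕ) → 1 ≤ r → 1 ≤ t →
    (r ≡ t → OhAtLeast (Star r ⊠ Star t) (r + 1)) ×
    (r ≢ t → OhAtLeast (Star r ⊠ Star t) ((r ⊓ t) + 2))
lemma10 (suc k) t (s≤s _) _ = diagonal , off-diagonal
  where
  diagonal : suc k ≡ t → OhAtLeast (Star (suc k) ⊠ Star t) (suc k + 1)
  diagonal refl rewrite +-comm k 1 = oh-Star⊠Star (n<1+n k) (n≤1+n k)

  off-diagonal : suc k ≢ t → OhAtLeast (Star (suc k) ⊠ Star t) (suc k ⊓ t + 2)
  off-diagonal r≢t with <-cmp (suc k) t
  ... | tri< r<t _ _ rewrite m≤n⇒m⊓n≡m (<⇒≤ r<t) | +-comm (suc k) 2 = oh-Star⊠Star′ ≤-refl r<t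
  ... | tri≈ _ r≡t _ = ⊥-elim (r≢t r≡t)
  ... | tri> _ _ t<r rewrite m≥n⇒m⊓n≡n (<⇒≤ t<r) | +-comm t 2 = oh-Star⊠Star t<r ≤-refl
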